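{- Writing $\Box F:=\,?!F$ for c-formulas and $\nabla\Phi:=\,!?\Phi$ for i-formulas, the following principles are derivable in QHC: 1. $\cdot\,\nabla\alpha\to\neg\neg\alpha$; 2. $\cdot\,\neg\nabla\alpha\leftrightarrow\neg\alpha$; 3. $\cdot\,\neg\alpha\leftrightarrow\nabla\neg\alpha$; 4. $\cdot\,\Box(p\land q)\leftrightarrow\Box p\land\Box q$; 5. $\cdot\,\nabla(\alpha\land\beta)\leftrightarrow\nabla\alpha\land\nabla\beta$.
   Context: Meta-logical framework. Formulas of a first-order language may contain individual variables and predicate variables. Meta-formulas are built from formulas using meta-conjunction $\&$, meta-implication $\Rightarrow$, and universal meta-quantifiers over individual and predicate variables. A principle $\cdot G$, for a formula $G$, is the meta-formula obtained by universally meta-quantifying all free individual variables of $G$ and then all predicate variables of $G$. A rule $F_1,\dots,F_m/G$ is the meta-formula $\forall^2(\forall^1F_1\,\&\cdots\&\,\forall^1F_m\Rightarrow\forall^1G)$, where $\forall^1$ meta-quantifies the free individual variables of the formula it precedes and $\forall^2$ meta-quantifies all predicate variables occurring. A logic $L$ is given by a derivation system $\mathcal D$, a meta-conjunction of finitely many principles and rules. For a meta-formula $\mathcal F$, $\vdash_L\mathcal F$ means that $\mathcal D\Rightarrow\mathcal F$ is derivable by the natural-deduction meta-rules: introduction and elimination of $\&$, $\Rightarrow$ and the universal meta-quantifiers (elimination allows substituting terms for individual variables and formulas for predicate variables), plus $\alpha$-conversion. Language of QHC. It has individual variables and, for each $n\ge0$, countably many $n$-ary problem variables $\alpha,\beta,\gamma,\delta,\theta,\dots$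 and countably many $n$-ary proper predicate variables $p,q,\dots$. - A c-formula is $\top$, $\bot$, an atom $p(x_1,\dots,x_n)$, or $?\Phi$ for an i-formula $\Phi$, closed under the classical connectives $\land,\lor,\to,\leftrightarrow,\neg$ and quantifiers $\exists,\forall$. - An i-formula is $\checkmark$ (triviality), $\curlywedge$ (absurdity), an atom $\alpha(x_1,\dots,x_n)$, or $!F$ for a c-formula $F$, closed under the intuitionistic connectives $\land,\lor,\to,\leftrightarrow,\neg$ (with $\neg\Phi:=\Phi\to\curlywedge$) and quantifiers $\exists,\forall$. Connectives applied to c-formulas are classical; those applied to i-formulas are intuitionistic. QHC is the logic whose derivation system consists of: - (0a) all laws and rules of classical predicate logic QC, for c-formulas; - (0b) all laws and rules of intuitionistic predicate logic QH, for i-formulas; - the principles $\cdot\,?(\gamma\land\delta)\leftrightarrow ?\gamma\land ?\delta$, $\cdot\,?(\gamma\lor\delta)\leftrightarrow ?\gamma\lor ?\delta$, $\cdot\,?(\gamma\to\delta)\to(?\gamma\to ?\delta)$, $\cdot\,\neg ?\curlywedge$, $\cdot\,?\exists x\,\theta(x)\leftrightarrow\exists x\,?\theta(x)$, $\cdot\,?\forall x\,\theta(x)\to\forall x\,?\theta(x)$, $\cdot\,\gamma\to\,!?\gamma$, $\cdot\,\neg !\bot$, $\cdot\,?!p\to p$, $\cdot\,!p\to\,!?!p$ and $\cdot\,!(p\to q)\to(!p\to !q)$; - the rules $!p/p$ and $p/!p$. -}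

module Defs where

open import Data.Nat using (ℕ; zero; suc)
open import Data.Vec using (Vec) renaming (map to vmap)
open import Data.Product using (_×_; _,_)

-- Syntax of QHC (de Bruijn indices for individual variables; the only
-- terms are individual variables, as in the paper's language).

infixr 30 _∧c_ _∧i_
infixr 25 _∨c_ _∨i_
infixr 20 _⇒c_ _⇒i_
infix 15 _⇔c_ _⇔i_
infix 40 ⁇_ ‼_ ¬c_ ¬i_ □_ ∇_
infix 5 ⊢c_ ⊢i_

mutual
  data CF : Set where
    ⊤c ⊥c  : CF
    atomc  : {n : ℕ} → ℕ → Vec ℕ n → CF
    ⁇_     : IF → CF
    _∧c_ _∨c_ _⇒c_ : CF → CF → CF
    ∀c ∃c  : CF → CF

  data IF : Set where
    ✓i ⅄i  : IF
    atomi  : {n : ℕ} → ℕ → Vec ℕ n → IF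
    ‼_     : CF → IF
    _∧i_ _∨i_ _⇒i_ : IF → IF → IF
    ∀i ∃i  : IF → IF

¬c_ : CF → CF
¬c F = F ⇒c ⊥c

¬i_ : IF → IF
¬i A = A ⇒i ⅄i

_⇔c_ : CF → CF → CF
F ⇔c G = (F ⇒c G) ∧c (G ⇒c F)

_⇔i_ : IF → IF → IF
A ⇔i B = (A ⇒i B) ∧i (B ⇒i A)

□_ : CF → CF
□ F = ⁇ (‼ F)

∇_ : IF → IF
∇ A = ‼ (⁇ A)

lift : (ℕ → ℕ) → ℕ → ℕ
lift ρ zero    = zero
lift ρ (suc k) = suc (ρ k)

mutual
  renC : (ℕ → ℕ) → CF → CF
  renC ρ ⊤c = ⊤c
  renC ρ ⊥c = ⊥c
  renC ρ (atomc k xs) = atomc k (vmap ρ xs)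
  renC ρ (⁇ A) = ⁇ (renI ρ A)
  renC ρ (F ∧c G) = renC ρ F ∧c renC ρ G
  renC ρ (F ∨c G) = renC ρ F ∨c renC ρ G
  renC ρ (F ⇒c G) = renC ρ F ⇒c renC ρ G
  renC ρ (∀c F) = ∀c (renC (lift ρ) F)
  renC ρ (∃c F) = ∃c (renC (lift ρ) F)

  renI : (ℕ → ℕ) → IF → IF
  renI ρ ✓i = ✓i
  renI ρ ⅄i = ⅄i
  renI ρ (atomi k xs) = atomi k (vmap ρ xs)
  renI ρ (‼ F) = ‼ (renC ρ F)
  renI ρ (A ∧i B) = renI ρ A ∧i renI ρ B
  renI ρ (A ∨i B) = renI ρ A ∨i renI ρ B
  renI ρ (A ⇒i B) = renI ρ A ⇒i renI ρ B
  renI ρ (∀i A) = ∀i (renI (lift ρ) A)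
  renI ρ (∃i A) = ∃i (renI (lift ρ) A)

inst : ℕ → ℕ → ℕ
inst t zero    = t
inst t (suc k) = k

-- weakening (the formula does not mention the new variable 0)
shC : CF → CF
shC = renC suc

shI : IF → IF
shI = renI suc

-- Then the QHC principles (as schemata, i.e. with
--      arbitrary formulas substituted for predicate variables) and rules.

mutual
  data ⊢c_ : CF → Set where
    c-K   : ∀ {F G} → ⊢c (F ⇒c G ⇒c F)
    c-S   : ∀ {F G H} → ⊢c ((F ⇒c G ⇒c H) ⇒c (F ⇒c G) ⇒c F ⇒c H)
    c-∧I  : ∀ {F G} → ⊢c (F ⇒c G ⇒c F ∧c G)
    c-∧E₁ : ∀ {F G} → ⊢c (F ∧c G ⇒c F)
    c-∧E₂ : ∀ {F G} → ⊢c (F ∧c G ⇒c G)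
    c-∨I₁ : ∀ {F G} → ⊢c (F ⇒c F ∨c G)
    c-∨I₂ : ∀ {F G} → ⊢c (G ⇒c F ∨c G)
    c-∨E  : ∀ {F G H} → ⊢c ((F ⇒c H) ⇒c (G ⇒c H) ⇒c F ∨c G ⇒c H)
    c-⊤I  : ⊢c ⊤c
    c-⊥E  : ∀ {F} → ⊢c (⊥c ⇒c F)
    c-DN  : ∀ {F} → ⊢c (¬c ¬c F ⇒c F)
    c-∀E  : ∀ {F} t → ⊢c (∀c F ⇒c renC (inst t) F)
    c-∃I  : ∀ {F} t → ⊢c (renC (inst t) F ⇒c ∃c F)
    c-MP  : ∀ {F G} → ⊢c (F ⇒c G) → ⊢c F → ⊢c G
    c-∀R  : ∀ {F G} → ⊢c (shC G ⇒c F) → ⊢c (G ⇒c ∀c F)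
    c-∃R  : ∀ {F G} → ⊢c (F ⇒c shC G) → ⊢c (∃c F ⇒c G)
    ax-?∧   : ∀ {A B} → ⊢c (⁇ (A ∧i B) ⇔c (⁇ A ∧c ⁇ B))
    ax-?∨   : ∀ {A B} → ⊢c (⁇ (A ∨i B) ⇔c (⁇ A ∨c ⁇ B))
    ax-?⇒   : ∀ {A B} → ⊢c (⁇ (A ⇒i B) ⇒c (⁇ A ⇒c ⁇ B))
    ax-¬?⅄  : ⊢c (¬c (⁇ ⅄i))
    ax-?∃   : ∀ {A} → ⊢c (⁇ (∃i A) ⇔c ∃c (⁇ A))
    ax-?∀   : ∀ {A} → ⊢c (⁇ (∀i A) ⇒c ∀c (⁇ A))
    ax-?!   : ∀ {F} → ⊢c (⁇ (‼ F) ⇒c F)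
    r-!/    : ∀ {F} → ⊢i (‼ F) → ⊢c F

  data ⊢i_ : IF → Set where
    i-K   : ∀ {A B} → ⊢i (A ⇒i B ⇒i A)
    i-S   : ∀ {A B C} → ⊢i ((A ⇒i B ⇒i C) ⇒i (A ⇒i B) ⇒i A ⇒i C)
    i-∧I  : ∀ {A B} → ⊢i (A ⇒i B ⇒i A ∧i B)
    i-∧E₁ : ∀ {A B} → ⊢i (A ∧i B ⇒i A)
    i-∧E₂ : ∀ {A B} → ⊢i (A ∧i B ⇒i B)
    i-∨I₁ : ∀ {A B} → ⊢i (A ⇒i A ∨i B)
    i-∨I₂ : ∀ {A B} → ⊢i (B ⇒i A ∨i B)
    i-∨E  : ∀ {A B C} → ⊢i ((A ⇒i C) ⇒i (B ⇒i C) ⇒i A ∨i B ⇒i C)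
    i-✓I  : ⊢i ✓i
    i-⅄E  : ∀ {A} → ⊢i (⅄i ⇒i A)
    i-∀E  : ∀ {A} t → ⊢i (∀i A ⇒i renI (inst t) A)
    i-∃I  : ∀ {A} t → ⊢i (renI (inst t) A ⇒i ∃i A)
    i-MP  : ∀ {A B} → ⊢i (A ⇒i B) → ⊢i A → ⊢i B
    i-∀R  : ∀ {A B} → ⊢i (shI B ⇒i A) → ⊢i (B ⇒i ∀i A)
    i-∃R  : ∀ {A B} → ⊢i (A ⇒i shI B) → ⊢i (∃i A ⇒i B)
    ax-!?   : ∀ {A} → ⊢i (A ⇒i ‼ (⁇ A))
    ax-¬!⊥  : ⊢i (¬i (‼ ⊥c))
    ax-!?!  : ∀ {F} → ⊢i (‼ F ⇒i ‼ (⁇ (‼ F)))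
    ax-!K   : ∀ {F G} → ⊢i (‼ (F ⇒c G) ⇒i (‼ F ⇒i ‼ G))
    r-/!    : ∀ {F} → ⊢c F → ⊢i (‼ F)

module Submission where

open import Defs
open import Data.Product using (_×_; _,_)

-- Both ! and ? are monotone (by the rules p/!p, !p/p and the K-principles) and commute with ∧,
-- so their composites ∇ and □ do too.  For negation, the unit γ → !?γ gives ¬α → ∇¬α, while
-- ¬?⅄ and ¬!⊥ push a negation through ? and ! in the other direction, giving ∇¬α → ¬∇α; the
-- unit once more turns ¬∇α into ¬α.

module IntuitionisticCombinators where

  ⇒-refl : ∀ {A} → ⊢i (A ⇒i A)
  ⇒-refl {A} = i-MP (i-MP (i-S {A} {A ⇒i A} {A}) i-K) i-K

  ⇒-trans : ∀ {A B C} → ⊢i (A ⇒i B) → ⊢i (B ⇒i C) → ⊢i (A ⇒i C)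
  ⇒-trans ab bc = i-MP (i-MP i-S (i-MP i-K bc)) ab

  ⇒-postcomp : ∀ {A B C} → ⊢i (B ⇒i C) → ⊢i ((A ⇒i B) ⇒i (A ⇒i C))
  ⇒-postcomp bc = i-MP i-S (i-MP i-K bc)

  ⇒-swap : ∀ {A B C} → ⊢i (A ⇒i B ⇒i C) → ⊢i (B ⇒i A ⇒i C)
  ⇒-swap h = ⇒-trans i-K (i-MP i-S h)

  ⇒-precomp : ∀ {A B C} → ⊢i (A ⇒i B) → ⊢i ((B ⇒i C) ⇒i (A ⇒i C))
  ⇒-precomp ab = ⇒-swap (⇒-trans ab (⇒-swap ⇒-refl))

  ∧-intro : ∀ {A B C} → ⊢i (A ⇒i B) → ⊢i (A ⇒i C) → ⊢i (A ⇒i B ∧i C)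
  ∧-intro ab ac = i-MP (i-MP i-S (⇒-trans ab i-∧I)) ac

  ∧-uncurry : ∀ {A B C} → ⊢i (A ⇒i B ⇒i C) → ⊢i (A ∧i B ⇒i C)
  ∧-uncurry h = i-MP (i-MP i-S (⇒-trans i-∧E₁ h)) i-∧E₂

  ⇔-intro : ∀ {A B} → ⊢i (A ⇒i B) → ⊢i (B ⇒i A) → ⊢i (A ⇔i B)
  ⇔-intro f g = i-MP (i-MP i-∧I f) g

  ⇔-elimˡ : ∀ {A B} → ⊢i (A ⇔i B) → ⊢i (A ⇒i B)
  ⇔-elimˡ = i-MP i-∧E₁

module ClassicalCombinators where

  ⇒-trans : ∀ {F G H} → ⊢c (F ⇒c G) → ⊢c (G ⇒c H) → ⊢c (F ⇒c H)
  ⇒-trans fg gh = c-MP (c-MP c-S (c-MP c-K gh)) fg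

  ⇒-postcomp : ∀ {F G H} → ⊢c (G ⇒c H) → ⊢c ((F ⇒c G) ⇒c (F ⇒c H))
  ⇒-postcomp gh = c-MP c-S (c-MP c-K gh)

  ∧-intro : ∀ {F G H} → ⊢c (F ⇒c G) → ⊢c (F ⇒c H) → ⊢c (F ⇒c G ∧c H)
  ∧-intro fg fh = c-MP (c-MP c-S (⇒-trans fg c-∧I)) fh

  ⇔-intro : ∀ {F G} → ⊢c (F ⇒c G) → ⊢c (G ⇒c F) → ⊢c (F ⇔c G)
  ⇔-intro f g = c-MP (c-MP c-∧I f) g

  ⇔-elimˡ : ∀ {F G} → ⊢c (F ⇔c G) → ⊢c (F ⇒c G)
  ⇔-elimˡ = c-MP c-∧E₁

  ⇔-elimʳ : ∀ {F G} → ⊢c (F ⇔c G) → ⊢c (G ⇒c F)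
  ⇔-elimʳ = c-MP c-∧E₂

open IntuitionisticCombinators
module C = ClassicalCombinators

‼-mono : ∀ {F G} → ⊢c (F ⇒c G) → ⊢i (‼ F ⇒i ‼ G)
‼-mono h = i-MP ax-!K (r-/! h)

⁇-mono : ∀ {A B} → ⊢i (A ⇒i B) → ⊢c (⁇ A ⇒c ⁇ B)
⁇-mono h = c-MP ax-?⇒ (r-!/ (i-MP ax-!? h))

‼-∧-intro : ∀ {F G} → ⊢i (‼ F ∧i ‼ G ⇒i ‼ (F ∧c G))
‼-∧-intro = ∧-uncurry (⇒-trans (‼-mono c-∧I) ax-!K)

‼-∧-elim : ∀ {F G} → ⊢i (‼ (F ∧c G) ⇒i ‼ F ∧i ‼ G)
‼-∧-elim = ∧-intro (‼-mono c-∧E₁) (‼-mono c-∧E₂)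

‼-¬⇒¬‼ : ∀ {F} → ⊢i (‼ (¬c F) ⇒i ¬i ‼ F)
‼-¬⇒¬‼ = ⇒-trans ax-!K (⇒-postcomp ax-¬!⊥)

⁇-¬⇒¬⁇ : ∀ {A} → ⊢c (⁇ (¬i A) ⇒c ¬c ⁇ A)
⁇-¬⇒¬⁇ = C.⇒-trans ax-?⇒ (C.⇒-postcomp ax-¬?⅄)

∇-¬⇒¬∇ : ∀ {A} → ⊢i (∇ (¬i A) ⇒i ¬i ∇ A)
∇-¬⇒¬∇ = ⇒-trans (‼-mono ⁇-¬⇒¬⁇) ‼-¬⇒¬‼

¬⇒¬∇ : ∀ {A} → ⊢i (¬i A ⇒i ¬i ∇ A)
¬⇒¬∇ = ⇒-trans ax-!? ∇-¬⇒¬∇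

∇⇒¬¬ : ∀ {A} → ⊢i (∇ A ⇒i ¬i ¬i A)
∇⇒¬¬ = ⇒-swap ¬⇒¬∇

¬∇⇔¬ : ∀ {A} → ⊢i (¬i (∇ A) ⇔i ¬i A)
¬∇⇔¬ = ⇔-intro (⇒-precomp ax-!?) ¬⇒¬∇

¬⇔∇¬ : ∀ {A} → ⊢i (¬i A ⇔i ∇ (¬i A))
¬⇔∇¬ = ⇔-intro ax-!? (⇒-trans ∇-¬⇒¬∇ (⇔-elimˡ ¬∇⇔¬))

□-∧ : ∀ {F G} → ⊢c (□ (F ∧c G) ⇔c (□ F ∧c □ G))
□-∧ = C.⇔-intro (C.∧-intro (⁇-mono (‼-mono c-∧E₁)) (⁇-mono (‼-mono c-∧E₂)))
                (C.⇒-trans (C.⇔-elimʳ ax-?∧) (⁇-mono ‼-∧-intro))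

∇-∧ : ∀ {A B} → ⊢i (∇ (A ∧i B) ⇔i (∇ A ∧i ∇ B))
∇-∧ = ⇔-intro (⇒-trans (‼-mono (C.⇔-elimˡ ax-?∧)) ‼-∧-elim)
              (⇒-trans ‼-∧-intro (‼-mono (C.⇔-elimʳ ax-?∧)))

mainTheorem11 : (∀ (A : IF) → ⊢i (∇ A ⇒i ¬i ¬i A))
                × (∀ (A : IF) → ⊢i (¬i (∇ A) ⇔i ¬i A))
                × (∀ (A : IF) → ⊢i (¬i A ⇔i ∇ (¬i A)))
                × (∀ (F G : CF) → ⊢c (□ (F ∧c G) ⇔c (□ F ∧c □ G)))
                × (∀ (A B : IF) → ⊢i (∇ (A ∧i B) ⇔i (∇ A ∧i ∇ B)))
mainTheorem11 =
    (λ _ → ∇⇒¬¬)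
  , (λ _ → ¬∇⇔¬)
  , (λ _ → ¬⇔∇¬)
  , (λ _ _ → □-∧)
  , (λ _ _ → ∇-∧)
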